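{- Let $\mathcal R$ be a representable map category. Then the category $\mathrm{Span}(\mathcal R)$ of spans in $\mathcal R$, equipped with the class of levelwise representable maps, is a representable map category.
   Context: A representable map category (RMC) is a category $\mathcal R$ with finite limits together with a class of morphisms called representable, closed under pullback, such that for every representable $f\colon Y\to X$ the pullback functor $f^*\colon\mathcal R/X\to\mathcal R/Y$ has a right adjoint $f_*$. For a category $\mathcal C$, $\mathrm{Span}(\mathcal C)$ is the category of functors from the diagram $\{0\leftarrow r\to1\}$ into $\mathcal C$. A morphism of spans $p\colon Y\to X$ is levelwise representable if its components $p_0,p_r,p_1$ are representable in $\mathcal R$. -}

module Defs where

open import Level using (Level; _⊔_) renaming (suc to lsuc)
open import Relation.Binary using (Rel; IsEquivalence; Setoid)
open import Data.Product using (Σ; _×_; _,_; proj₁; proj₂)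
import Relation.Binary.Reasoning.Setoid as SetoidR

record Category (o ℓ e : Level) : Set (lsuc (o ⊔ ℓ ⊔ e)) where
  infix  4 _≈_
  infixr 9 _∘_
  field
    Obj       : Set o
    _⇒_       : Obj → Obj → Set ℓ
    _≈_       : ∀ {A B} → Rel (A ⇒ B) e
    id        : ∀ {A} → A ⇒ A
    _∘_       : ∀ {A B C} → B ⇒ C → A ⇒ B → A ⇒ C
    equiv     : ∀ {A B} → IsEquivalence (_≈_ {A} {B})
    assoc     : ∀ {A B C D} {f : A ⇒ B} {g : B ⇒ C} {h : C ⇒ D} →
                (h ∘ g) ∘ f ≈ h ∘ (g ∘ f)
    identityˡ : ∀ {A B} {f : A ⇒ B} → id ∘ f ≈ f
    identityʳ : ∀ {A B} {f : A ⇒ B} → f ∘ id ≈ f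
    ∘-resp-≈  : ∀ {A B C} {f h : B ⇒ C} {g i : A ⇒ B} →
                f ≈ h → g ≈ i → f ∘ g ≈ h ∘ i

  hom-setoid : ∀ {A B} → Setoid ℓ e
  hom-setoid {A} {B} = record { Carrier = A ⇒ B ; _≈_ = _≈_ ; isEquivalence = equiv }

  module Eq {A B} = IsEquivalence (equiv {A} {B})

  glue : ∀ {A B C A' B' C'} {a : A ⇒ A'} {b : B ⇒ B'} {c : C ⇒ C'}
           {f : A ⇒ B} {g : B ⇒ C} {f' : A' ⇒ B'} {g' : B' ⇒ C'} →
         f' ∘ a ≈ b ∘ f → g' ∘ b ≈ c ∘ g → (g' ∘ f') ∘ a ≈ c ∘ (g ∘ f)
  glue {A = A} {C' = C'} {a = a} {b} {c} {f} {g} {f'} {g'} sq₁ sq₂ = begin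
      (g' ∘ f') ∘ a   ≈⟨ assoc ⟩
      g' ∘ (f' ∘ a)   ≈⟨ ∘-resp-≈ Eq.refl sq₁ ⟩
      g' ∘ (b ∘ f)    ≈⟨ Eq.sym assoc ⟩
      (g' ∘ b) ∘ f    ≈⟨ ∘-resp-≈ sq₂ Eq.refl ⟩
      (c ∘ g) ∘ f     ≈⟨ assoc ⟩
      c ∘ (g ∘ f)     ∎
    where open SetoidR (hom-setoid {A} {C'})

record Functor {o ℓ e o' ℓ' e'} (C : Category o ℓ e) (D : Category o' ℓ' e')
       : Set (o ⊔ ℓ ⊔ e ⊔ o' ⊔ ℓ' ⊔ e') where
  private
    module C = Category C
    module D = Category D
  field
    F₀           : C.Obj → D.Obj
    F₁           : ∀ {A B} → A C.⇒ B → F₀ A D.⇒ F₀ B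
    identity     : ∀ {A} → F₁ (C.id {A}) D.≈ D.id
    homomorphism : ∀ {X Y Z} {f : X C.⇒ Y} {g : Y C.⇒ Z} →
                   F₁ (g C.∘ f) D.≈ F₁ g D.∘ F₁ f
    F-resp-≈     : ∀ {A B} {f g : A C.⇒ B} → f C.≈ g → F₁ f D.≈ F₁ g

record Adjunction {o ℓ e o' ℓ' e'} {C : Category o ℓ e} {D : Category o' ℓ' e'}
       (L : Functor C D) (R : Functor D C) : Set (o ⊔ ℓ ⊔ e ⊔ o' ⊔ ℓ' ⊔ e') where
  private
    module C = Category C
    module D = Category D
    module L = Functor L
    module R = Functor R
  field
    unit           : ∀ A → A C.⇒ R.F₀ (L.F₀ A)
    counit         : ∀ B → L.F₀ (R.F₀ B) D.⇒ B
    unit-natural   : ∀ {A A'} (f : A C.⇒ A') →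
                     unit A' C.∘ f C.≈ R.F₁ (L.F₁ f) C.∘ unit A
    counit-natural : ∀ {B B'} (g : B D.⇒ B') →
                     counit B' D.∘ L.F₁ (R.F₁ g) D.≈ g D.∘ counit B
    zig            : ∀ {A} → counit (L.F₀ A) D.∘ L.F₁ (unit A) D.≈ D.id
    zag            : ∀ {B} → R.F₁ (counit B) C.∘ unit (R.F₀ B) C.≈ C.id

HasRightAdjoint : ∀ {o ℓ e o' ℓ' e'} {C : Category o ℓ e} {D : Category o' ℓ' e'} →
                  Functor C D → Set (o ⊔ ℓ ⊔ e ⊔ o' ⊔ ℓ' ⊔ e')
HasRightAdjoint {C = C} {D = D} L = Σ (Functor D C) λ R → Adjunction L R

module _ {o ℓ e} (C : Category o ℓ e) where
  open Category C

  record IsTerminal (T : Obj) : Set (o ⊔ ℓ ⊔ e) where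
    field
      !        : ∀ {A} → A ⇒ T
      !-unique : ∀ {A} (h : A ⇒ T) → h ≈ !

  record Terminal : Set (o ⊔ ℓ ⊔ e) where
    field
      ⊤          : Obj
      isTerminal : IsTerminal ⊤

  record IsPullback {P A B X : Obj} (f : A ⇒ X) (g : B ⇒ X)
                    (p₁ : P ⇒ A) (p₂ : P ⇒ B) : Set (o ⊔ ℓ ⊔ e) where
    field
      commute   : f ∘ p₁ ≈ g ∘ p₂
      universal : ∀ {Q} (q₁ : Q ⇒ A) (q₂ : Q ⇒ B) → f ∘ q₁ ≈ g ∘ q₂ → Q ⇒ P
      p₁∘universal : ∀ {Q} {q₁ : Q ⇒ A} {q₂ : Q ⇒ B} (eq : f ∘ q₁ ≈ g ∘ q₂) →
                     p₁ ∘ universal q₁ q₂ eq ≈ q₁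
      p₂∘universal : ∀ {Q} {q₁ : Q ⇒ A} {q₂ : Q ⇒ B} (eq : f ∘ q₁ ≈ g ∘ q₂) →
                     p₂ ∘ universal q₁ q₂ eq ≈ q₂
      unique    : ∀ {Q} {q₁ : Q ⇒ A} {q₂ : Q ⇒ B} (eq : f ∘ q₁ ≈ g ∘ q₂)
                    (u : Q ⇒ P) → p₁ ∘ u ≈ q₁ → p₂ ∘ u ≈ q₂ →
                    u ≈ universal q₁ q₂ eq

  record Pullback {A B X : Obj} (f : A ⇒ X) (g : B ⇒ X) : Set (o ⊔ ℓ ⊔ e) where
    field
      P          : Obj
      p₁         : P ⇒ A
      p₂         : P ⇒ B
      isPullback : IsPullback f g p₁ p₂
    open IsPullback isPullback public

  record FiniteLimits : Set (o ⊔ ℓ ⊔ e) where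
    field
      terminal : Terminal
      pullback : ∀ {A B X} (f : A ⇒ X) (g : B ⇒ X) → Pullback f g

  record SliceObj (X : Obj) : Set (o ⊔ ℓ) where
    constructor sliceobj
    field
      {dom} : Obj
      arr   : dom ⇒ X

  record Slice⇒ {X : Obj} (A B : SliceObj X) : Set (ℓ ⊔ e) where
    constructor slicearr
    private
      module A = SliceObj A
      module B = SliceObj B
    field
      {h}      : A.dom ⇒ B.dom
      triangle : B.arr ∘ h ≈ A.arr

  Slice : Obj → Category (o ⊔ ℓ) (ℓ ⊔ e) e
  Slice X = record
    { Obj       = SliceObj X
    ; _⇒_       = Slice⇒
    ; _≈_       = λ f g → Slice⇒.h f ≈ Slice⇒.h g
    ; id        = slicearr identityʳ
    ; _∘_       = λ {A} {B} {D} g f → slicearr (comp {A} {B} {D} g f)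
    ; equiv     = record { refl = Eq.refl ; sym = Eq.sym ; trans = Eq.trans }
    ; assoc     = assoc
    ; identityˡ = identityˡ
    ; identityʳ = identityʳ
    ; ∘-resp-≈  = ∘-resp-≈
    }
    where
    comp : ∀ {A B D : SliceObj X} (g : Slice⇒ B D) (f : Slice⇒ A B) →
           SliceObj.arr D ∘ (Slice⇒.h g ∘ Slice⇒.h f) ≈ SliceObj.arr A
    comp {A} {B} {D} (slicearr {g} tg) (slicearr {f} tf) = begin
        SliceObj.arr D ∘ (g ∘ f)  ≈⟨ Eq.sym assoc ⟩
        (SliceObj.arr D ∘ g) ∘ f  ≈⟨ ∘-resp-≈ tg Eq.refl ⟩
        SliceObj.arr B ∘ f        ≈⟨ tf ⟩
        SliceObj.arr A            ∎
      where open SetoidR hom-setoid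

  module _ (FL : FiniteLimits) where
    open FiniteLimits FL

    pullbackFunctor : ∀ {X Y} (f : Y ⇒ X) → Functor (Slice X) (Slice Y)
    pullbackFunctor {X} {Y} f = record
      { F₀           = λ a → sliceobj (Pullback.p₂ (pb a))
      ; F₁           = λ {a} {b} u → slicearr {h = F₁h a b u} (Pullback.p₂∘universal (pb b) (sq a b u))
      ; identity     = λ {a} → Eq.sym (Pullback.unique (pb a) (sq a a idS) id
                         (Eq.trans identityʳ (Eq.sym identityˡ)) identityʳ)
      ; homomorphism = λ {a} {b} {c} {u} {v} → homo a b c u v
      ; F-resp-≈     = λ {a} {b} {u} {v} u≈v → resp a b u v u≈v
      }
      where
      pb : (a : SliceObj X) → Pullback (SliceObj.arr a) f
      pb a = pullback (SliceObj.arr a) f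
      idS : ∀ {a} → Slice⇒ a a
      idS = slicearr identityʳ
      sq : (a b : SliceObj X) (u : Slice⇒ a b) →
           SliceObj.arr b ∘ (Slice⇒.h u ∘ Pullback.p₁ (pb a)) ≈ f ∘ Pullback.p₂ (pb a)
      sq a b (slicearr {u} t) = begin
          SliceObj.arr b ∘ (u ∘ Pullback.p₁ (pb a))  ≈⟨ Eq.sym assoc ⟩
          (SliceObj.arr b ∘ u) ∘ Pullback.p₁ (pb a)  ≈⟨ ∘-resp-≈ t Eq.refl ⟩
          SliceObj.arr a ∘ Pullback.p₁ (pb a)        ≈⟨ Pullback.commute (pb a) ⟩
          f ∘ Pullback.p₂ (pb a)                     ∎
        where open SetoidR hom-setoid
      F₁h : (a b : SliceObj X) (u : Slice⇒ a b) → Pullback.P (pb a) ⇒ Pullback.P (pb b)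
      F₁h a b u = Pullback.universal (pb b) _ _ (sq a b u)
      homo : (a b c : SliceObj X) (u : Slice⇒ a b) (v : Slice⇒ b c) →
             F₁h a c (Category._∘_ (Slice X) v u) ≈ F₁h b c v ∘ F₁h a b u
      homo a b c u v = Eq.sym (Pullback.unique (pb c) (sq a c (Category._∘_ (Slice X) v u)) _
        (let open SetoidR hom-setoid in begin
          Pullback.p₁ (pb c) ∘ (F₁h b c v ∘ F₁h a b u)  ≈⟨ Eq.sym assoc ⟩
          (Pullback.p₁ (pb c) ∘ F₁h b c v) ∘ F₁h a b u  ≈⟨ ∘-resp-≈ (Pullback.p₁∘universal (pb c) (sq b c v)) Eq.refl ⟩
          (Slice⇒.h v ∘ Pullback.p₁ (pb b)) ∘ F₁h a b u ≈⟨ assoc ⟩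
          Slice⇒.h v ∘ (Pullback.p₁ (pb b) ∘ F₁h a b u) ≈⟨ ∘-resp-≈ Eq.refl (Pullback.p₁∘universal (pb b) (sq a b u)) ⟩
          Slice⇒.h v ∘ (Slice⇒.h u ∘ Pullback.p₁ (pb a)) ≈⟨ Eq.sym assoc ⟩
          (Slice⇒.h v ∘ Slice⇒.h u) ∘ Pullback.p₁ (pb a) ∎)
        (let open SetoidR hom-setoid in begin
          Pullback.p₂ (pb c) ∘ (F₁h b c v ∘ F₁h a b u)  ≈⟨ Eq.sym assoc ⟩
          (Pullback.p₂ (pb c) ∘ F₁h b c v) ∘ F₁h a b u  ≈⟨ ∘-resp-≈ (Pullback.p₂∘universal (pb c) (sq b c v)) Eq.refl ⟩
          Pullback.p₂ (pb b) ∘ F₁h a b u                ≈⟨ Pullback.p₂∘universal (pb b) (sq a b u) ⟩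
          Pullback.p₂ (pb a)                            ∎))
      resp : (a b : SliceObj X) (u v : Slice⇒ a b) → Slice⇒.h u ≈ Slice⇒.h v →
             F₁h a b u ≈ F₁h a b v
      resp a b u v u≈v = Eq.sym (Pullback.unique (pb b) (sq a b u) (F₁h a b v)
        (Eq.trans (Pullback.p₁∘universal (pb b) (sq a b v)) (∘-resp-≈ (Eq.sym u≈v) Eq.refl))
        (Pullback.p₂∘universal (pb b) (sq a b v)))

  ClosedUnderPullback : ∀ {r} → (∀ {A B} → A ⇒ B → Set r) → Set (o ⊔ ℓ ⊔ e ⊔ r)
  ClosedUnderPullback Rep =
    ∀ {P A B X} {f : A ⇒ X} {g : B ⇒ X} {p₁ : P ⇒ A} {p₂ : P ⇒ B} →
    IsPullback f g p₁ p₂ → Rep f → Rep p₂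

  record IsRMC {r} (Rep : ∀ {A B} → A ⇒ B → Set r) : Set (o ⊔ ℓ ⊔ e ⊔ r) where
    field
      finiteLimits        : FiniteLimits
      rep-pullback-stable : ClosedUnderPullback Rep
      rep-exponentiable   : ∀ {X Y} (f : Y ⇒ X) → Rep f →
                            HasRightAdjoint (pullbackFunctor finiteLimits f)

-- Span(C) = functor category [ 0 ← r → 1 , C ], written out explicitly

module _ {o ℓ e} (C : Category o ℓ e) where
  open Category C

  record SpanObj : Set (o ⊔ ℓ) where
    constructor span
    field
      {X₀ Xᵣ X₁} : Obj
      left  : Xᵣ ⇒ X₀
      right : Xᵣ ⇒ X₁

  record Span⇒ (S T : SpanObj) : Set (ℓ ⊔ e) where
    constructor spanarr
    private
      module S = SpanObj S
      module T = SpanObj T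
    field
      f₀ : S.X₀ ⇒ T.X₀
      fᵣ : S.Xᵣ ⇒ T.Xᵣ
      f₁ : S.X₁ ⇒ T.X₁
      left-sq  : f₀ ∘ S.left  ≈ T.left  ∘ fᵣ
      right-sq : f₁ ∘ S.right ≈ T.right ∘ fᵣ

  record _≈S_ {S T : SpanObj} (f g : Span⇒ S T) : Set e where
    field
      eq₀ : Span⇒.f₀ f ≈ Span⇒.f₀ g
      eqᵣ : Span⇒.fᵣ f ≈ Span⇒.fᵣ g
      eq₁ : Span⇒.f₁ f ≈ Span⇒.f₁ g

  Span : Category (o ⊔ ℓ) (ℓ ⊔ e) e
  Span = record
    { Obj       = SpanObj
    ; _⇒_       = Span⇒
    ; _≈_       = _≈S_
    ; id        = spanarr id id id (Eq.trans identityˡ (Eq.sym identityʳ))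
                                   (Eq.trans identityˡ (Eq.sym identityʳ))
    ; _∘_       = λ g f → spanarr (Span⇒.f₀ g ∘ Span⇒.f₀ f) (Span⇒.fᵣ g ∘ Span⇒.fᵣ f)
                                  (Span⇒.f₁ g ∘ Span⇒.f₁ f)
                                  (glue (Span⇒.left-sq f) (Span⇒.left-sq g))
                                  (glue (Span⇒.right-sq f) (Span⇒.right-sq g))
    ; equiv     = record
        { refl  = record { eq₀ = Eq.refl ; eqᵣ = Eq.refl ; eq₁ = Eq.refl }
        ; sym   = λ p → record { eq₀ = Eq.sym (_≈S_.eq₀ p) ; eqᵣ = Eq.sym (_≈S_.eqᵣ p)
                                ; eq₁ = Eq.sym (_≈S_.eq₁ p) }
        ; trans = λ p q → record { eq₀ = Eq.trans (_≈S_.eq₀ p) (_≈S_.eq₀ q)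
                                  ; eqᵣ = Eq.trans (_≈S_.eqᵣ p) (_≈S_.eqᵣ q)
                                  ; eq₁ = Eq.trans (_≈S_.eq₁ p) (_≈S_.eq₁ q) }
        }
    ; assoc     = record { eq₀ = assoc ; eqᵣ = assoc ; eq₁ = assoc }
    ; identityˡ = record { eq₀ = identityˡ ; eqᵣ = identityˡ ; eq₁ = identityˡ }
    ; identityʳ = record { eq₀ = identityʳ ; eqᵣ = identityʳ ; eq₁ = identityʳ }
    ; ∘-resp-≈  = λ p q → record { eq₀ = ∘-resp-≈ (_≈S_.eq₀ p) (_≈S_.eq₀ q)
                                  ; eqᵣ = ∘-resp-≈ (_≈S_.eqᵣ p) (_≈S_.eqᵣ q)
                                  ; eq₁ = ∘-resp-≈ (_≈S_.eq₁ p) (_≈S_.eq₁ q) }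
    }

  LevelwiseRep : ∀ {r} → (∀ {A B} → A ⇒ B → Set r) →
                 ∀ {S T : SpanObj} → Span⇒ S T → Set r
  LevelwiseRep Rep p = Rep (Span⇒.f₀ p) × Rep (Span⇒.fᵣ p) × Rep (Span⇒.f₁ p)

{-# OPTIONS --safe #-}
-- Pullbacks and the terminal object of Span(R) are computed levelwise, and every pullback
-- square of spans is isomorphic to the chosen one, hence levelwise a pullback square; so
-- levelwise representable maps are stable under pullback.  For exponentiability one builds the
-- right adjoint Π_p of p* levelwise.  For a levelwise representable p : Y → X and a : A → Y,
-- the feet of Π_p a are Π_{p₀} a₀ and Π_{p₁} a₁.  A point of its apex over x ∈ Xᵣ is a section
-- s ∈ Π_{pᵣ} aᵣ together with, for each leg l (to level i = 0, 1), a section t ∈ Π_{pᵢ} aᵢ over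
-- l x that is compatible with s, i.e. lA ∘ s = t ∘ lY on the fibre of pᵣ over x.  Compatibility
-- is an equation in Π_{pᵣ}(lY* aᵢ) between the image of s under postcomposition with lA and
-- the image of t under the Beck–Chevalley map lX* Π_{pᵢ} → Π_{pᵣ} lY*.  So the apex is a finite
-- limit of dependent products in R, and the universal property of Π_p a follows leg by leg from
-- the universal properties of the three levelwise dependent products.
module Submission where

open import Defs
open import Level using (Level; _⊔_)
open import Data.Product using (_×_; _,_)

module HomReasoning {o ℓ e} (C : Category o ℓ e) where
  open Category C public

  infix  1 begin_
  infixr 2 _≈⟨_⟩_ _≈˘⟨_⟩_
  infix  3 _∎
  infixr 4 _⟩∘⟨_ refl⟩∘⟨_
  infixl 5 _⟩∘⟨refl

  begin_ : ∀ {A B} {f g : A ⇒ B} → f ≈ g → f ≈ g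
  begin p = p

  _≈⟨_⟩_ : ∀ {A B} (f : A ⇒ B) {g h : A ⇒ B} → f ≈ g → g ≈ h → f ≈ h
  f ≈⟨ p ⟩ q = Eq.trans p q

  _≈˘⟨_⟩_ : ∀ {A B} (f : A ⇒ B) {g h : A ⇒ B} → g ≈ f → g ≈ h → f ≈ h
  f ≈˘⟨ p ⟩ q = Eq.trans (Eq.sym p) q

  _∎ : ∀ {A B} (f : A ⇒ B) → f ≈ f
  f ∎ = Eq.refl

  _⟩∘⟨_ : ∀ {A B C} {f h : B ⇒ C} {g i : A ⇒ B} → f ≈ h → g ≈ i → f ∘ g ≈ h ∘ i
  _⟩∘⟨_ = ∘-resp-≈

  refl⟩∘⟨_ : ∀ {A B C} {f : B ⇒ C} {g i : A ⇒ B} → g ≈ i → f ∘ g ≈ f ∘ i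
  refl⟩∘⟨ p = ∘-resp-≈ Eq.refl p

  _⟩∘⟨refl : ∀ {A B C} {f h : B ⇒ C} {g : A ⇒ B} → f ≈ h → f ∘ g ≈ h ∘ g
  p ⟩∘⟨refl = ∘-resp-≈ p Eq.refl

  pullˡ : ∀ {A B C D} {a : C ⇒ D} {b : B ⇒ C} {c : B ⇒ D} → a ∘ b ≈ c →
          ∀ {f : A ⇒ B} → a ∘ (b ∘ f) ≈ c ∘ f
  pullˡ p = Eq.trans (Eq.sym assoc) (p ⟩∘⟨refl)

  pullʳ : ∀ {A B C D} {b : B ⇒ C} {c : A ⇒ B} {d : A ⇒ C} → b ∘ c ≈ d →
          ∀ {a : C ⇒ D} → (a ∘ b) ∘ c ≈ a ∘ d
  pullʳ p = Eq.trans assoc (refl⟩∘⟨ p)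

  extendˡ : ∀ {A A′ B B′ C} {a : B ⇒ C} {b : A ⇒ B} {c : B′ ⇒ C} {d : A ⇒ B′} →
            a ∘ b ≈ c ∘ d → ∀ {f : A′ ⇒ A} → a ∘ (b ∘ f) ≈ c ∘ (d ∘ f)
  extendˡ p = Eq.trans (pullˡ p) assoc

module _ {o ℓ e o′ ℓ′ e′} {C : Category o ℓ e} {D : Category o′ ℓ′ e′}
         (L : Functor C D) where
  private
    module C = Category C
    module D = Category D
    module L = Functor L

  record CouniversalArrow (B : D.Obj) : Set (o ⊔ ℓ ⊔ e ⊔ ℓ′ ⊔ e′) where
    field
      G₀               : C.Obj
      ε                : L.F₀ G₀ D.⇒ B
      transpose        : ∀ {A} → L.F₀ A D.⇒ B → A C.⇒ G₀
      ε∘transpose      : ∀ {A} (f : L.F₀ A D.⇒ B) → ε D.∘ L.F₁ (transpose f) D.≈ f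
      transpose-unique : ∀ {A} {f : L.F₀ A D.⇒ B} (g : A C.⇒ G₀) →
                         ε D.∘ L.F₁ g D.≈ f → g C.≈ transpose f

  couniversalArrow : HasRightAdjoint L → ∀ B → CouniversalArrow B
  couniversalArrow (G , adj) B = record
    { G₀               = G.F₀ B
    ; ε                = counit B
    ; transpose        = transpose
    ; ε∘transpose      = ε∘transpose
    ; transpose-unique = transpose-unique
    }
    where
    module G = Functor G
    open Adjunction adj

    transpose : ∀ {A} → L.F₀ A D.⇒ B → A C.⇒ G.F₀ B
    transpose {A} f = G.F₁ f C.∘ unit A

    ε∘transpose : ∀ {A} (f : L.F₀ A D.⇒ B) → counit B D.∘ L.F₁ (transpose f) D.≈ f
    ε∘transpose {A} f = begin
      counit B D.∘ L.F₁ (G.F₁ f C.∘ unit A)                ≈⟨ refl⟩∘⟨ L.homomorphism ⟩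
      counit B D.∘ (L.F₁ (G.F₁ f) D.∘ L.F₁ (unit A))       ≈⟨ pullˡ (counit-natural f) ⟩
      (f D.∘ counit (L.F₀ A)) D.∘ L.F₁ (unit A)            ≈⟨ pullʳ zig ⟩
      f D.∘ D.id                                           ≈⟨ D.identityʳ ⟩
      f                                                    ∎
      where open HomReasoning D

    transpose-unique : ∀ {A} {f : L.F₀ A D.⇒ B} (g : A C.⇒ G.F₀ B) →
                       counit B D.∘ L.F₁ g D.≈ f → g C.≈ transpose f
    transpose-unique {A} {f} g εLg≈f = begin
      g                                                    ≈˘⟨ C.identityˡ ⟩
      C.id C.∘ g                                           ≈˘⟨ zag ⟩∘⟨refl ⟩
      (G.F₁ (counit B) C.∘ unit (G.F₀ B)) C.∘ g            ≈⟨ pullʳ (unit-natural g) ⟩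
      G.F₁ (counit B) C.∘ (G.F₁ (L.F₁ g) C.∘ unit A)       ≈⟨ pullˡ (C.Eq.sym G.homomorphism) ⟩
      G.F₁ (counit B D.∘ L.F₁ g) C.∘ unit A                ≈⟨ G.F-resp-≈ εLg≈f ⟩∘⟨refl ⟩
      G.F₁ f C.∘ unit A                                    ∎
      where open HomReasoning C

  rightAdjoint : (∀ B → CouniversalArrow B) → HasRightAdjoint L
  rightAdjoint U = G , adjunction
    where
    module U B = CouniversalArrow (U B)
    open HomReasoning D

    transpose-resp-≈ : ∀ {A B} {f g : L.F₀ A D.⇒ B} → f D.≈ g →
                       U.transpose B f C.≈ U.transpose B g
    transpose-resp-≈ {B = B} {f} f≈g =
      U.transpose-unique B (U.transpose B f) (Eq.trans (U.ε∘transpose B f) f≈g)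

    transpose-∘ : ∀ {A A′ B} (f : L.F₀ A′ D.⇒ B) (g : A C.⇒ A′) →
                  U.transpose B f C.∘ g C.≈ U.transpose B (f D.∘ L.F₁ g)
    transpose-∘ {B = B} f g = U.transpose-unique B _ (begin
      U.ε B ∘ L.F₁ (U.transpose B f C.∘ g)         ≈⟨ refl⟩∘⟨ L.homomorphism ⟩
      U.ε B ∘ (L.F₁ (U.transpose B f) ∘ L.F₁ g)    ≈⟨ pullˡ (U.ε∘transpose B f) ⟩
      f ∘ L.F₁ g                                   ∎)

    G : Functor D C
    G = record
      { F₀           = U.G₀
      ; F₁           = λ {A} {B} h → U.transpose B (h ∘ U.ε A)
      ; identity     = λ {A} → C.Eq.sym (U.transpose-unique A C.id (begin
          U.ε A ∘ L.F₁ C.id  ≈⟨ refl⟩∘⟨ L.identity ⟩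
          U.ε A ∘ id         ≈⟨ identityʳ ⟩
          U.ε A              ≈˘⟨ identityˡ ⟩
          id ∘ U.ε A         ∎))
      ; homomorphism = λ {X} {Y} {Z} {f} {g} → C.Eq.trans
          (transpose-resp-≈ (Eq.trans (pullʳ (Eq.sym (U.ε∘transpose Y _))) (Eq.sym assoc)))
          (C.Eq.sym (transpose-∘ (g ∘ U.ε Y) (U.transpose Y (f ∘ U.ε X))))
      ; F-resp-≈     = λ f≈g → transpose-resp-≈ (f≈g ⟩∘⟨refl)
      }

    unit : ∀ A → A C.⇒ U.G₀ (L.F₀ A)
    unit A = U.transpose (L.F₀ A) id

    unit-natural : ∀ {A A′} (f : A C.⇒ A′) → unit A′ C.∘ f C.≈ Functor.F₁ G (L.F₁ f) C.∘ unit A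
    unit-natural {A} f = C.Eq.trans (transpose-∘ id f) (C.Eq.trans
      (transpose-resp-≈ (begin
        id ∘ L.F₁ f                                  ≈⟨ identityˡ ⟩
        L.F₁ f                                       ≈˘⟨ identityʳ ⟩
        L.F₁ f ∘ id                                  ≈˘⟨ pullʳ (U.ε∘transpose (L.F₀ A) id) ⟩
        (L.F₁ f ∘ U.ε (L.F₀ A)) ∘ L.F₁ (unit A)      ∎))
      (C.Eq.sym (transpose-∘ _ (unit A))))

    zag : ∀ {B} → Functor.F₁ G (U.ε B) C.∘ unit (U.G₀ B) C.≈ C.id
    zag {B} = C.Eq.trans (transpose-∘ _ (unit (U.G₀ B))) (C.Eq.trans
      (transpose-resp-≈ (Eq.trans (pullʳ (U.ε∘transpose _ id)) identityʳ))
      (C.Eq.sym (U.transpose-unique B C.id (Eq.trans (refl⟩∘⟨ L.identity) identityʳ))))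

    adjunction : Adjunction L G
    adjunction = record
      { unit           = unit
      ; counit         = U.ε
      ; unit-natural   = unit-natural
      ; counit-natural = λ g → U.ε∘transpose _ _
      ; zig            = U.ε∘transpose _ _
      ; zag            = zag
      }

module PullbackProperties {o ℓ e} (C : Category o ℓ e) where
  open HomReasoning C

  module _ {A B X} {f : A ⇒ X} {g : B ⇒ X} where

    IsPullback-ext : ∀ {P} {p₁ : P ⇒ A} {p₂ : P ⇒ B} → IsPullback C f g p₁ p₂ →
                     ∀ {Z} {x y : Z ⇒ P} → p₁ ∘ x ≈ p₁ ∘ y → p₂ ∘ x ≈ p₂ ∘ y → x ≈ y
    IsPullback-ext {p₁ = p₁} {p₂} pb {y = y} e₁ e₂ =
      Eq.trans (unique sq _ e₁ e₂) (Eq.sym (unique sq y Eq.refl Eq.refl))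
      where
      open IsPullback pb
      sq : f ∘ (p₁ ∘ y) ≈ g ∘ (p₂ ∘ y)
      sq = Eq.trans (pullˡ commute) assoc

    module _ {P Q} {p₁ : P ⇒ A} {p₂ : P ⇒ B} {q₁ : Q ⇒ A} {q₂ : Q ⇒ B}
             (pb : IsPullback C f g p₁ p₂) (pb′ : IsPullback C f g q₁ q₂) where

      comparison : P ⇒ Q
      comparison = IsPullback.universal pb′ p₁ p₂ (IsPullback.commute pb)

      p₁∘comparison : q₁ ∘ comparison ≈ p₁
      p₁∘comparison = IsPullback.p₁∘universal pb′ (IsPullback.commute pb)

      p₂∘comparison : q₂ ∘ comparison ≈ p₂
      p₂∘comparison = IsPullback.p₂∘universal pb′ (IsPullback.commute pb)

    comparison-inverse : ∀ {P Q} {p₁ : P ⇒ A} {p₂ : P ⇒ B} {q₁ : Q ⇒ A} {q₂ : Q ⇒ B}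
                         (pb : IsPullback C f g p₁ p₂) (pb′ : IsPullback C f g q₁ q₂) →
                         comparison pb′ pb ∘ comparison pb pb′ ≈ id
    comparison-inverse pb pb′ = IsPullback-ext pb
      (Eq.trans (pullˡ (p₁∘comparison pb′ pb)) (Eq.trans (p₁∘comparison pb pb′) (Eq.sym identityʳ)))
      (Eq.trans (pullˡ (p₂∘comparison pb′ pb)) (Eq.trans (p₂∘comparison pb pb′) (Eq.sym identityʳ)))

    IsPullback-resp-iso : ∀ {P Q} {p₁ : P ⇒ A} {p₂ : P ⇒ B} {q₁ : Q ⇒ A} {q₂ : Q ⇒ B} →
                          IsPullback C f g q₁ q₂ → (u : P ⇒ Q) (v : Q ⇒ P) →
                          v ∘ u ≈ id → u ∘ v ≈ id → q₁ ∘ u ≈ p₁ → q₂ ∘ u ≈ p₂ →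
                          IsPullback C f g p₁ p₂
    IsPullback-resp-iso {P} {Q} {p₁} {p₂} {q₁} {q₂} pb u v v∘u u∘v q₁∘u q₂∘u = record
      { commute      = begin
          f ∘ p₁        ≈˘⟨ refl⟩∘⟨ q₁∘u ⟩
          f ∘ (q₁ ∘ u)  ≈⟨ pullˡ Q.commute ⟩
          (g ∘ q₂) ∘ u  ≈⟨ pullʳ q₂∘u ⟩
          g ∘ p₂        ∎
      ; universal    = λ h₁ h₂ sq → v ∘ Q.universal h₁ h₂ sq
      ; p₁∘universal = λ sq → Eq.trans (pullˡ (p∘v q₁∘u)) (Q.p₁∘universal sq)
      ; p₂∘universal = λ sq → Eq.trans (pullˡ (p∘v q₂∘u)) (Q.p₂∘universal sq)
      ; unique       = λ sq w p₁∘w p₂∘w → begin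
          w                  ≈˘⟨ identityˡ ⟩
          id ∘ w             ≈˘⟨ v∘u ⟩∘⟨refl ⟩
          (v ∘ u) ∘ w        ≈⟨ pullʳ (Q.unique sq (u ∘ w) (Eq.trans (pullˡ q₁∘u) p₁∘w)
                                                   (Eq.trans (pullˡ q₂∘u) p₂∘w)) ⟩
          v ∘ Q.universal _ _ sq ∎
      }
      where
      module Q = IsPullback pb
      p∘v : ∀ {D} {q : Q ⇒ D} {p : P ⇒ D} → q ∘ u ≈ p → p ∘ v ≈ q
      p∘v {q = q} {p} q∘u = begin
        p ∘ v        ≈˘⟨ q∘u ⟩∘⟨refl ⟩
        (q ∘ u) ∘ v  ≈⟨ pullʳ u∘v ⟩
        q ∘ id       ≈⟨ identityʳ ⟩
        q            ∎

module ChosenPullbacks {o ℓ e} {C : Category o ℓ e} (FL : FiniteLimits C) where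
  open HomReasoning C
  open FiniteLimits FL
  open PullbackProperties C using (IsPullback-ext)

  module PB {A B X} (f : A ⇒ X) (g : B ⇒ X) = Pullback (pullback f g)

  PB-ext : ∀ {A B X} {f : A ⇒ X} {g : B ⇒ X} {Z} {x y : Z ⇒ PB.P f g} →
           PB.p₁ f g ∘ x ≈ PB.p₁ f g ∘ y → PB.p₂ f g ∘ x ≈ PB.p₂ f g ∘ y → x ≈ y
  PB-ext {f = f} {g} = IsPullback-ext (PB.isPullback f g)

  module _ {Y X} (f : Y ⇒ X) {Z Z′} {z : Z ⇒ X} {z′ : Z′ ⇒ X} (g : Z ⇒ Z′) (tri : z′ ∘ g ≈ z) where
    -- Here and below, proofs passed to universal properties are opaque: otherwise objects
    -- built from such maps unfold into their proof terms during unification, and the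
    -- terms grow exponentially.
    private
      opaque
        sq : z′ ∘ (g ∘ PB.p₁ z f) ≈ f ∘ PB.p₂ z f
        sq = Eq.trans (pullˡ tri) (PB.commute z f)

    pullback₁ : PB.P z f ⇒ PB.P z′ f
    pullback₁ = PB.universal z′ f _ _ sq

    p₁∘pullback₁ : PB.p₁ z′ f ∘ pullback₁ ≈ g ∘ PB.p₁ z f
    p₁∘pullback₁ = PB.p₁∘universal z′ f sq

    p₂∘pullback₁ : PB.p₂ z′ f ∘ pullback₁ ≈ PB.p₂ z f
    p₂∘pullback₁ = PB.p₂∘universal z′ f sq

  module _ {A₀ Aᵣ B₀ Bᵣ X₀ Xᵣ} {f₀ : A₀ ⇒ X₀} {g₀ : B₀ ⇒ X₀} {fᵣ : Aᵣ ⇒ Xᵣ} {gᵣ : Bᵣ ⇒ Xᵣ}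
           {lA : Aᵣ ⇒ A₀} {lB : Bᵣ ⇒ B₀} {lX : Xᵣ ⇒ X₀}
           (f-sq : f₀ ∘ lA ≈ lX ∘ fᵣ) (g-sq : g₀ ∘ lB ≈ lX ∘ gᵣ) where
    private
      opaque
        sq : f₀ ∘ (lA ∘ PB.p₁ fᵣ gᵣ) ≈ g₀ ∘ (lB ∘ PB.p₂ fᵣ gᵣ)
        sq = Eq.trans (extendˡ f-sq) (Eq.trans (refl⟩∘⟨ PB.commute fᵣ gᵣ) (Eq.sym (extendˡ g-sq)))

    pullbackMap : PB.P fᵣ gᵣ ⇒ PB.P f₀ g₀
    pullbackMap = PB.universal f₀ g₀ _ _ sq

    p₁∘pullbackMap : PB.p₁ f₀ g₀ ∘ pullbackMap ≈ lA ∘ PB.p₁ fᵣ gᵣ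
    p₁∘pullbackMap = PB.p₁∘universal f₀ g₀ sq

    p₂∘pullbackMap : PB.p₂ f₀ g₀ ∘ pullbackMap ≈ lB ∘ PB.p₂ fᵣ gᵣ
    p₂∘pullbackMap = PB.p₂∘universal f₀ g₀ sq

    opaque
      universal-natural : ∀ {Q₀ Qᵣ} {lQ : Qᵣ ⇒ Q₀} {a₀ : Q₀ ⇒ A₀} {b₀ : Q₀ ⇒ B₀}
                            {aᵣ : Qᵣ ⇒ Aᵣ} {bᵣ : Qᵣ ⇒ Bᵣ}
                          (e₀ : f₀ ∘ a₀ ≈ g₀ ∘ b₀) (eᵣ : fᵣ ∘ aᵣ ≈ gᵣ ∘ bᵣ) →
                          a₀ ∘ lQ ≈ lA ∘ aᵣ → b₀ ∘ lQ ≈ lB ∘ bᵣ →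
                          PB.universal f₀ g₀ a₀ b₀ e₀ ∘ lQ ≈ pullbackMap ∘ PB.universal fᵣ gᵣ aᵣ bᵣ eᵣ
      universal-natural e₀ eᵣ a-sq b-sq = PB-ext
        (Eq.trans (pullˡ (PB.p₁∘universal f₀ g₀ e₀)) (Eq.trans a-sq
          (Eq.sym (Eq.trans (pullˡ p₁∘pullbackMap) (pullʳ (PB.p₁∘universal fᵣ gᵣ eᵣ))))))
        (Eq.trans (pullˡ (PB.p₂∘universal f₀ g₀ e₀)) (Eq.trans b-sq
          (Eq.sym (Eq.trans (pullˡ p₂∘pullbackMap) (pullʳ (PB.p₂∘universal fᵣ gᵣ eᵣ))))))

module SpanLimits {o ℓ e} {R : Category o ℓ e} (FL : FiniteLimits R) where
  open HomReasoning R
  open ChosenPullbacks FL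
  open PullbackProperties R using (IsPullback-resp-iso)
  open SpanObj
  open Span⇒
  open _≈S_

  spanPullback : ∀ {A B X : SpanObj R} (f : Span⇒ R A X) (g : Span⇒ R B X) → Pullback (Span R) f g
  spanPullback f g = record
    { P          = span (pullbackMap (left-sq f) (left-sq g)) (pullbackMap (right-sq f) (right-sq g))
    ; p₁         = spanarr (PB.p₁ (f₀ f) (f₀ g)) (PB.p₁ (fᵣ f) (fᵣ g)) (PB.p₁ (f₁ f) (f₁ g))
                           (p₁∘pullbackMap (left-sq f) (left-sq g)) (p₁∘pullbackMap (right-sq f) (right-sq g))
    ; p₂         = spanarr (PB.p₂ (f₀ f) (f₀ g)) (PB.p₂ (fᵣ f) (fᵣ g)) (PB.p₂ (f₁ f) (f₁ g))
                           (p₂∘pullbackMap (left-sq f) (left-sq g)) (p₂∘pullbackMap (right-sq f) (right-sq g))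
    ; isPullback = record
      { commute      = record { eq₀ = PB.commute (f₀ f) (f₀ g) ; eqᵣ = PB.commute (fᵣ f) (fᵣ g)
                              ; eq₁ = PB.commute (f₁ f) (f₁ g) }
      ; universal    = λ q₁ q₂ sq → spanarr
          (PB.universal (f₀ f) (f₀ g) _ _ (eq₀ sq)) (PB.universal (fᵣ f) (fᵣ g) _ _ (eqᵣ sq))
          (PB.universal (f₁ f) (f₁ g) _ _ (eq₁ sq))
          (universal-natural (left-sq f) (left-sq g) (eq₀ sq) (eqᵣ sq) (left-sq q₁) (left-sq q₂))
          (universal-natural (right-sq f) (right-sq g) (eq₁ sq) (eqᵣ sq) (right-sq q₁) (right-sq q₂))
      ; p₁∘universal = λ sq → record { eq₀ = PB.p₁∘universal (f₀ f) (f₀ g) (eq₀ sq)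
                                     ; eqᵣ = PB.p₁∘universal (fᵣ f) (fᵣ g) (eqᵣ sq)
                                     ; eq₁ = PB.p₁∘universal (f₁ f) (f₁ g) (eq₁ sq) }
      ; p₂∘universal = λ sq → record { eq₀ = PB.p₂∘universal (f₀ f) (f₀ g) (eq₀ sq)
                                     ; eqᵣ = PB.p₂∘universal (fᵣ f) (fᵣ g) (eqᵣ sq)
                                     ; eq₁ = PB.p₂∘universal (f₁ f) (f₁ g) (eq₁ sq) }
      ; unique       = λ sq u p₁∘u p₂∘u → record
          { eq₀ = PB.unique (f₀ f) (f₀ g) (eq₀ sq) (f₀ u) (eq₀ p₁∘u) (eq₀ p₂∘u)
          ; eqᵣ = PB.unique (fᵣ f) (fᵣ g) (eqᵣ sq) (fᵣ u) (eqᵣ p₁∘u) (eqᵣ p₂∘u)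
          ; eq₁ = PB.unique (f₁ f) (f₁ g) (eq₁ sq) (f₁ u) (eq₁ p₁∘u) (eq₁ p₂∘u) }
      }
    }

  spanTerminal : Terminal (Span R)
  spanTerminal = record
    { ⊤          = span {X₀ = ⊤} {⊤} {⊤} id id
    ; isTerminal = record
      { !        = spanarr ! ! ! !-unique₂ !-unique₂
      ; !-unique = λ _ → record { eq₀ = !-unique _ ; eqᵣ = !-unique _ ; eq₁ = !-unique _ }
      }
    }
    where
    open Terminal (FiniteLimits.terminal FL)
    open IsTerminal isTerminal
    !-unique₂ : ∀ {A} {x y : A ⇒ ⊤} → x ≈ y
    !-unique₂ {x = x} {y} = Eq.trans (!-unique x) (Eq.sym (!-unique y))

  spanFiniteLimits : FiniteLimits (Span R)
  spanFiniteLimits = record { terminal = spanTerminal ; pullback = spanPullback }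

  IsPullback-levelwise : ∀ {P A B X : SpanObj R} {f : Span⇒ R A X} {g : Span⇒ R B X}
                           {p₁ : Span⇒ R P A} {p₂ : Span⇒ R P B} →
                         IsPullback (Span R) f g p₁ p₂ →
                         IsPullback R (f₀ f) (f₀ g) (f₀ p₁) (f₀ p₂) ×
                         IsPullback R (fᵣ f) (fᵣ g) (fᵣ p₁) (fᵣ p₂) ×
                         IsPullback R (f₁ f) (f₁ g) (f₁ p₁) (f₁ p₂)
  IsPullback-levelwise {P} {f = f} {g} {p₁} {p₂} pb =
      IsPullback-resp-iso (PB.isPullback (f₀ f) (f₀ g)) (f₀ u) (f₀ v)
        (eq₀ v∘u) (eq₀ u∘v) (eq₀ p₁∘u) (eq₀ p₂∘u)
    , IsPullback-resp-iso (PB.isPullback (fᵣ f) (fᵣ g)) (fᵣ u) (fᵣ v)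
        (eqᵣ v∘u) (eqᵣ u∘v) (eqᵣ p₁∘u) (eqᵣ p₂∘u)
    , IsPullback-resp-iso (PB.isPullback (f₁ f) (f₁ g)) (f₁ u) (f₁ v)
        (eq₁ v∘u) (eq₁ u∘v) (eq₁ p₁∘u) (eq₁ p₂∘u)
    where
    open PullbackProperties (Span R)
      using (comparison; comparison-inverse; p₁∘comparison; p₂∘comparison)
    module S = Pullback (spanPullback f g)
    module SR = Category (Span R)
    u : Span⇒ R P S.P
    u = comparison pb S.isPullback
    v : Span⇒ R S.P P
    v = comparison S.isPullback pb
    v∘u : v SR.∘ u SR.≈ SR.id
    v∘u = comparison-inverse pb S.isPullback
    u∘v : u SR.∘ v SR.≈ SR.id
    u∘v = comparison-inverse S.isPullback pb
    p₁∘u : S.p₁ SR.∘ u SR.≈ p₁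
    p₁∘u = p₁∘comparison pb S.isPullback
    p₂∘u : S.p₂ SR.∘ u SR.≈ p₂
    p₂∘u = p₂∘comparison pb S.isPullback

  levelwise-closedUnderPullback : ∀ {r} {Rep : ∀ {A B} → A ⇒ B → Set r} →
                                  ClosedUnderPullback R Rep →
                                  ClosedUnderPullback (Span R) (LevelwiseRep R Rep)
  levelwise-closedUnderPullback stable pb (r₀ , rᵣ , r₁) =
    let pb₀ , pbᵣ , pb₁ = IsPullback-levelwise pb in stable pb₀ r₀ , stable pbᵣ rᵣ , stable pb₁ r₁

module DependentProducts {o ℓ e} {R : Category o ℓ e} (FL : FiniteLimits R) where
  open HomReasoning R
  open ChosenPullbacks FL

  -- ev-β and lam-unique accept any k with the projections of the canonical comparison map,
  -- so that they apply to the levels of maps between pullbacks in Span R.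
  record DependentProduct {X Y B} (f : Y ⇒ X) (b : B ⇒ Y) : Set (o ⊔ ℓ ⊔ e) where
    field
      Π          : Obj
      π          : Π ⇒ X
      ev         : PB.P π f ⇒ B
      b∘ev       : b ∘ ev ≈ PB.p₂ π f
      lam        : ∀ {Z} (z : Z ⇒ X) (φ : PB.P z f ⇒ B) → b ∘ φ ≈ PB.p₂ z f → Z ⇒ Π
      π∘lam      : ∀ {Z} {z : Z ⇒ X} {φ} (t : b ∘ φ ≈ PB.p₂ z f) → π ∘ lam z φ t ≈ z
      ev-β       : ∀ {Z} {z : Z ⇒ X} {φ} (t : b ∘ φ ≈ PB.p₂ z f) {k : PB.P z f ⇒ PB.P π f} →
                   PB.p₁ π f ∘ k ≈ lam z φ t ∘ PB.p₁ z f → PB.p₂ π f ∘ k ≈ PB.p₂ z f →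
                   ev ∘ k ≈ φ
      lam-unique : ∀ {Z} {z : Z ⇒ X} {φ} (t : b ∘ φ ≈ PB.p₂ z f) (g : Z ⇒ Π) → π ∘ g ≈ z →
                   {k : PB.P z f ⇒ PB.P π f} →
                   PB.p₁ π f ∘ k ≈ g ∘ PB.p₁ z f → PB.p₂ π f ∘ k ≈ PB.p₂ z f →
                   ev ∘ k ≈ φ → g ≈ lam z φ t

  Exponentiable : ∀ {X Y} → Y ⇒ X → Set (o ⊔ ℓ ⊔ e)
  Exponentiable {Y = Y} f = ∀ {B} (b : B ⇒ Y) → DependentProduct f b

  exponentiable : ∀ {X Y} {f : Y ⇒ X} → HasRightAdjoint (pullbackFunctor R FL f) → Exponentiable f
  exponentiable {f = f} Πf b = record
    { Π          = SliceObj.dom G₀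
    ; π          = SliceObj.arr G₀
    ; ev         = Slice⇒.h ε
    ; b∘ev       = Slice⇒.triangle ε
    ; lam        = λ z φ t → Slice⇒.h (transpose (slicearr t))
    ; π∘lam      = λ t → Slice⇒.triangle (transpose (slicearr t))
    ; ev-β       = λ t p₁∘k p₂∘k →
        Eq.trans (refl⟩∘⟨ PB.unique (SliceObj.arr G₀) f _ _ p₁∘k p₂∘k) (ε∘transpose (slicearr t))
    ; lam-unique = λ t g π∘g p₁∘k p₂∘k ev∘k → transpose-unique (slicearr π∘g)
        (Eq.trans (refl⟩∘⟨ Eq.sym (PB.unique (SliceObj.arr G₀) f _ _ p₁∘k p₂∘k)) ev∘k)
    }
    where open CouniversalArrow (couniversalArrow (pullbackFunctor R FL f) Πf (sliceobj b))

  module LegConstruction {Xᵢ Xᵣ Yᵢ Yᵣ Aᵢ Aᵣ} {lX : Xᵣ ⇒ Xᵢ} {lY : Yᵣ ⇒ Yᵢ} {lA : Aᵣ ⇒ Aᵢ}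
           {pᵢ : Yᵢ ⇒ Xᵢ} {pᵣ : Yᵣ ⇒ Xᵣ} {aᵢ : Aᵢ ⇒ Yᵢ} {aᵣ : Aᵣ ⇒ Yᵣ}
           (p-sq : pᵢ ∘ lY ≈ lX ∘ pᵣ) (a-sq : aᵢ ∘ lA ≈ lY ∘ aᵣ)
           (Πᵢ : Exponentiable pᵢ) (Πᵣ : Exponentiable pᵣ) where
    -- One leg (lX, lY, lA) of spans, from level r to level i.  In the notation of the header:
    -- A* = lY* Aᵢ, Eᵢ = Π_{pᵢ} aᵢ, Eᵣ = Π_{pᵣ} aᵣ, E* = Π_{pᵣ}(lY* aᵢ), Q = lX* Eᵢ, and W is
    -- the object of compatible pairs (s, t).
    module A* = PB aᵢ lY
    module Eᵢ = DependentProduct (Πᵢ aᵢ)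
    module Eᵣ = DependentProduct (Πᵣ aᵣ)
    module E* = DependentProduct (Πᵣ A*.p₂)
    module Pᵢ = PB Eᵢ.π pᵢ
    module Pᵣ = PB Eᵣ.π pᵣ
    module P* = PB E*.π pᵣ
    module Q = PB Eᵢ.π lX
    module PQ = PB Q.p₂ pᵣ

    lA* : Aᵣ ⇒ A*.P
    lA* = A*.universal lA aᵣ a-sq

    opaque
      A*-p₂∘lA*∘ev : A*.p₂ ∘ (lA* ∘ Eᵣ.ev) ≈ Pᵣ.p₂
      A*-p₂∘lA*∘ev = Eq.trans (pullˡ (A*.p₂∘universal a-sq)) Eᵣ.b∘ev

    postcompose : Eᵣ.Π ⇒ E*.Π
    postcompose = E*.lam Eᵣ.π (lA* ∘ Eᵣ.ev) A*-p₂∘lA*∘ev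

    opaque
      π∘postcompose : E*.π ∘ postcompose ≈ Eᵣ.π
      π∘postcompose = E*.π∘lam A*-p₂∘lA*∘ev

    opaque
      PQ⇒Pᵢ-sq : Eᵢ.π ∘ (Q.p₁ ∘ PQ.p₁) ≈ pᵢ ∘ (lY ∘ PQ.p₂)
      PQ⇒Pᵢ-sq = Eq.trans (extendˡ Q.commute) (Eq.trans (refl⟩∘⟨ PQ.commute) (Eq.sym (extendˡ p-sq)))

    PQ⇒Pᵢ : PQ.P ⇒ Pᵢ.P
    PQ⇒Pᵢ = Pᵢ.universal _ _ PQ⇒Pᵢ-sq

    opaque
      evQ-sq : aᵢ ∘ (Eᵢ.ev ∘ PQ⇒Pᵢ) ≈ lY ∘ PQ.p₂
      evQ-sq = Eq.trans (pullˡ Eᵢ.b∘ev) (Pᵢ.p₂∘universal PQ⇒Pᵢ-sq)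

    evQ : PQ.P ⇒ A*.P
    evQ = A*.universal _ _ evQ-sq

    opaque
      A*-p₂∘evQ : A*.p₂ ∘ evQ ≈ PQ.p₂
      A*-p₂∘evQ = A*.p₂∘universal evQ-sq

    beckChevalley : Q.P ⇒ E*.Π
    beckChevalley = E*.lam Q.p₂ evQ A*-p₂∘evQ

    opaque
      π∘beckChevalley : E*.π ∘ beckChevalley ≈ Q.p₂
      π∘beckChevalley = E*.π∘lam A*-p₂∘evQ

    module W = PB postcompose beckChevalley

    leg : W.P ⇒ Eᵢ.Π
    leg = Q.p₁ ∘ W.p₂

    Q-p₂∘W-p₂ : Q.p₂ ∘ W.p₂ ≈ Eᵣ.π ∘ W.p₁
    Q-p₂∘W-p₂ = begin
      Q.p₂ ∘ W.p₂                      ≈˘⟨ π∘beckChevalley ⟩∘⟨refl ⟩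
      (E*.π ∘ beckChevalley) ∘ W.p₂    ≈⟨ pullʳ (Eq.sym W.commute) ⟩
      E*.π ∘ (postcompose ∘ W.p₁)      ≈⟨ pullˡ π∘postcompose ⟩
      Eᵣ.π ∘ W.p₁                      ∎

    π∘leg : Eᵢ.π ∘ leg ≈ lX ∘ (Eᵣ.π ∘ W.p₁)
    π∘leg = Eq.trans (extendˡ Q.commute) (refl⟩∘⟨ Q-p₂∘W-p₂)

    W-ext : ∀ {Z} {w w′ : Z ⇒ W.P} → W.p₁ ∘ w ≈ W.p₁ ∘ w′ → leg ∘ w ≈ leg ∘ w′ → w ≈ w′
    W-ext {w = w} {w′} e₁ e₂ = PB-ext e₁ (PB-ext (Eq.trans (Eq.sym assoc) (Eq.trans e₂ assoc)) (begin
      Q.p₂ ∘ (W.p₂ ∘ w)    ≈⟨ extendˡ Q-p₂∘W-p₂ ⟩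
      Eᵣ.π ∘ (W.p₁ ∘ w)    ≈⟨ refl⟩∘⟨ e₁ ⟩
      Eᵣ.π ∘ (W.p₁ ∘ w′)   ≈˘⟨ extendˡ Q-p₂∘W-p₂ ⟩
      Q.p₂ ∘ (W.p₂ ∘ w′)   ∎))

    P*-postcompose : Pᵣ.P ⇒ P*.P
    P*-postcompose = pullback₁ pᵣ postcompose π∘postcompose

    P*-beckChevalley : PQ.P ⇒ P*.P
    P*-beckChevalley = pullback₁ pᵣ beckChevalley π∘beckChevalley

    ev∘P*-postcompose : E*.ev ∘ P*-postcompose ≈ lA* ∘ Eᵣ.ev
    ev∘P*-postcompose = E*.ev-β A*-p₂∘lA*∘ev
      (p₁∘pullback₁ pᵣ postcompose π∘postcompose) (p₂∘pullback₁ pᵣ postcompose π∘postcompose)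

    ev∘P*-beckChevalley : E*.ev ∘ P*-beckChevalley ≈ evQ
    ev∘P*-beckChevalley = E*.ev-β A*-p₂∘evQ
      (p₁∘pullback₁ pᵣ beckChevalley π∘beckChevalley) (p₂∘pullback₁ pᵣ beckChevalley π∘beckChevalley)

    -- Evaluation at a family c of compatible pairs (s, t) commutes with the legs, lA ∘ s = t ∘ lY;
    -- u and v are the maps from the fibre product over z into the domains of Eᵣ.ev and Eᵢ.ev.
    module _ {Z} {z : Z ⇒ Xᵣ} (c : Z ⇒ W.P)
             {u : PB.P z pᵣ ⇒ Pᵣ.P} (p₁∘u : Pᵣ.p₁ ∘ u ≈ (W.p₁ ∘ c) ∘ PB.p₁ z pᵣ)
             (p₂∘u : Pᵣ.p₂ ∘ u ≈ PB.p₂ z pᵣ)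
             {v : PB.P z pᵣ ⇒ Pᵢ.P} (p₁∘v : Pᵢ.p₁ ∘ v ≈ (leg ∘ c) ∘ PB.p₁ z pᵣ)
             (p₂∘v : Pᵢ.p₂ ∘ v ≈ lY ∘ PB.p₂ z pᵣ) where
      private
        module Z* = PB z pᵣ

        opaque
          toPQ-sq : Q.p₂ ∘ ((W.p₂ ∘ c) ∘ Z*.p₁) ≈ pᵣ ∘ Z*.p₂
          toPQ-sq = begin
            Q.p₂ ∘ ((W.p₂ ∘ c) ∘ Z*.p₁)   ≈˘⟨ assoc ⟩
            (Q.p₂ ∘ (W.p₂ ∘ c)) ∘ Z*.p₁   ≈⟨ pullˡ Q-p₂∘W-p₂ ⟩∘⟨refl ⟩
            ((Eᵣ.π ∘ W.p₁) ∘ c) ∘ Z*.p₁   ≈⟨ Eq.trans (assoc ⟩∘⟨refl) assoc ⟩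
            Eᵣ.π ∘ ((W.p₁ ∘ c) ∘ Z*.p₁)   ≈˘⟨ refl⟩∘⟨ p₁∘u ⟩
            Eᵣ.π ∘ (Pᵣ.p₁ ∘ u)            ≈⟨ pullˡ Pᵣ.commute ⟩
            (pᵣ ∘ Pᵣ.p₂) ∘ u              ≈⟨ pullʳ p₂∘u ⟩
            pᵣ ∘ Z*.p₂                    ∎

        toPQ : Z*.P ⇒ PQ.P
        toPQ = PQ.universal _ _ toPQ-sq

        W-commute* : P*-postcompose ∘ u ≈ P*-beckChevalley ∘ toPQ
        W-commute* = PB-ext
          (begin
            P*.p₁ ∘ (P*-postcompose ∘ u)       ≈⟨ pullˡ (p₁∘pullback₁ pᵣ postcompose π∘postcompose) ⟩
            (postcompose ∘ Pᵣ.p₁) ∘ u          ≈⟨ pullʳ p₁∘u ⟩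
            postcompose ∘ ((W.p₁ ∘ c) ∘ Z*.p₁) ≈⟨ refl⟩∘⟨ assoc ⟩
            postcompose ∘ (W.p₁ ∘ (c ∘ Z*.p₁)) ≈⟨ extendˡ W.commute ⟩
            beckChevalley ∘ (W.p₂ ∘ (c ∘ Z*.p₁)) ≈˘⟨ refl⟩∘⟨ Eq.trans (PQ.p₁∘universal toPQ-sq) assoc ⟩
            beckChevalley ∘ (PQ.p₁ ∘ toPQ)     ≈˘⟨ extendˡ (p₁∘pullback₁ pᵣ beckChevalley π∘beckChevalley) ⟩
            P*.p₁ ∘ (P*-beckChevalley ∘ toPQ)  ∎)
          (begin
            P*.p₂ ∘ (P*-postcompose ∘ u)       ≈⟨ pullˡ (p₂∘pullback₁ pᵣ postcompose π∘postcompose) ⟩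
            Pᵣ.p₂ ∘ u                          ≈⟨ p₂∘u ⟩
            Z*.p₂                              ≈˘⟨ PQ.p₂∘universal toPQ-sq ⟩
            PQ.p₂ ∘ toPQ                       ≈˘⟨ pullˡ (p₂∘pullback₁ pᵣ beckChevalley π∘beckChevalley) ⟩
            P*.p₂ ∘ (P*-beckChevalley ∘ toPQ)  ∎)

        PQ⇒Pᵢ∘toPQ : PQ⇒Pᵢ ∘ toPQ ≈ v
        PQ⇒Pᵢ∘toPQ = PB-ext
          (begin
            Pᵢ.p₁ ∘ (PQ⇒Pᵢ ∘ toPQ)             ≈⟨ pullˡ (Pᵢ.p₁∘universal PQ⇒Pᵢ-sq) ⟩
            (Q.p₁ ∘ PQ.p₁) ∘ toPQ              ≈⟨ pullʳ (PQ.p₁∘universal toPQ-sq) ⟩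
            Q.p₁ ∘ ((W.p₂ ∘ c) ∘ Z*.p₁)        ≈˘⟨ Eq.trans (assoc ⟩∘⟨refl) assoc ⟩
            (leg ∘ c) ∘ Z*.p₁                  ≈˘⟨ p₁∘v ⟩
            Pᵢ.p₁ ∘ v                          ∎)
          (begin
            Pᵢ.p₂ ∘ (PQ⇒Pᵢ ∘ toPQ)             ≈⟨ pullˡ (Pᵢ.p₂∘universal PQ⇒Pᵢ-sq) ⟩
            (lY ∘ PQ.p₂) ∘ toPQ                ≈⟨ pullʳ (PQ.p₂∘universal toPQ-sq) ⟩
            lY ∘ Z*.p₂                         ≈˘⟨ p₂∘v ⟩
            Pᵢ.p₂ ∘ v                          ∎)

      ev-sq : lA ∘ (Eᵣ.ev ∘ u) ≈ Eᵢ.ev ∘ v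
      ev-sq = begin
        lA ∘ (Eᵣ.ev ∘ u)                        ≈˘⟨ pullˡ (A*.p₁∘universal a-sq) ⟩
        A*.p₁ ∘ (lA* ∘ (Eᵣ.ev ∘ u))             ≈˘⟨ refl⟩∘⟨ Eq.trans (pullˡ ev∘P*-postcompose) assoc ⟩
        A*.p₁ ∘ (E*.ev ∘ (P*-postcompose ∘ u))  ≈⟨ refl⟩∘⟨ refl⟩∘⟨ W-commute* ⟩
        A*.p₁ ∘ (E*.ev ∘ (P*-beckChevalley ∘ toPQ)) ≈⟨ refl⟩∘⟨ pullˡ ev∘P*-beckChevalley ⟩
        A*.p₁ ∘ (evQ ∘ toPQ)                    ≈⟨ pullˡ (A*.p₁∘universal evQ-sq) ⟩
        (Eᵢ.ev ∘ PQ⇒Pᵢ) ∘ toPQ                  ≈⟨ pullʳ PQ⇒Pᵢ∘toPQ ⟩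
        Eᵢ.ev ∘ v                               ∎

    module Transpose {Zᵢ Zᵣ} {lZ : Zᵣ ⇒ Zᵢ} {zᵢ : Zᵢ ⇒ Xᵢ} {zᵣ : Zᵣ ⇒ Xᵣ} (z-sq : zᵢ ∘ lZ ≈ lX ∘ zᵣ)
             {φᵢ : PB.P zᵢ pᵢ ⇒ Aᵢ} (tᵢ : aᵢ ∘ φᵢ ≈ PB.p₂ zᵢ pᵢ)
             {φᵣ : PB.P zᵣ pᵣ ⇒ Aᵣ} (tᵣ : aᵣ ∘ φᵣ ≈ PB.p₂ zᵣ pᵣ)
             {lZ* : PB.P zᵣ pᵣ ⇒ PB.P zᵢ pᵢ} (p₁∘lZ* : PB.p₁ zᵢ pᵢ ∘ lZ* ≈ lZ ∘ PB.p₁ zᵣ pᵣ)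
             (p₂∘lZ* : PB.p₂ zᵢ pᵢ ∘ lZ* ≈ lY ∘ PB.p₂ zᵣ pᵣ) (φ-sq : φᵢ ∘ lZ* ≈ lA ∘ φᵣ) where
      private
        module Zᵢ* = PB zᵢ pᵢ
        module Zᵣ* = PB zᵣ pᵣ

      ψᵢ : Zᵢ ⇒ Eᵢ.Π
      ψᵢ = Eᵢ.lam zᵢ φᵢ tᵢ

      ψᵣ : Zᵣ ⇒ Eᵣ.Π
      ψᵣ = Eᵣ.lam zᵣ φᵣ tᵣ

      private
        opaque
          ψQ-sq : Eᵢ.π ∘ (ψᵢ ∘ lZ) ≈ lX ∘ zᵣ
          ψQ-sq = Eq.trans (pullˡ (Eᵢ.π∘lam tᵢ)) z-sq

        ψQ : Zᵣ ⇒ Q.P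
        ψQ = Q.universal _ _ ψQ-sq

        opaque
          φ*-sq : aᵢ ∘ (φᵢ ∘ lZ*) ≈ lY ∘ Zᵣ*.p₂
          φ*-sq = Eq.trans (pullˡ tᵢ) p₂∘lZ*

        φ* : Zᵣ*.P ⇒ A*.P
        φ* = A*.universal _ _ φ*-sq

        opaque
          A*-p₂∘φ* : A*.p₂ ∘ φ* ≈ Zᵣ*.p₂
          A*-p₂∘φ* = A*.p₂∘universal φ*-sq

        Pᵣ-ψᵣ : Zᵣ*.P ⇒ Pᵣ.P
        Pᵣ-ψᵣ = pullback₁ pᵣ ψᵣ (Eᵣ.π∘lam tᵣ)

        Pᵢ-ψᵢ : Zᵢ*.P ⇒ Pᵢ.P
        Pᵢ-ψᵢ = pullback₁ pᵢ ψᵢ (Eᵢ.π∘lam tᵢ)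

        PQ-ψQ : Zᵣ*.P ⇒ PQ.P
        PQ-ψQ = pullback₁ pᵣ ψQ (Q.p₂∘universal ψQ-sq)

        lA*∘φᵣ : lA* ∘ φᵣ ≈ φ*
        lA*∘φᵣ = PB-ext
          (Eq.trans (pullˡ (A*.p₁∘universal a-sq)) (Eq.trans (Eq.sym φ-sq) (Eq.sym (A*.p₁∘universal φ*-sq))))
          (Eq.trans (pullˡ (A*.p₂∘universal a-sq)) (Eq.trans tᵣ (Eq.sym A*-p₂∘φ*)))

        PQ⇒Pᵢ∘PQ-ψQ : PQ⇒Pᵢ ∘ PQ-ψQ ≈ Pᵢ-ψᵢ ∘ lZ*
        PQ⇒Pᵢ∘PQ-ψQ = PB-ext
          (begin
            Pᵢ.p₁ ∘ (PQ⇒Pᵢ ∘ PQ-ψQ)  ≈⟨ pullˡ (Pᵢ.p₁∘universal PQ⇒Pᵢ-sq) ⟩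
            (Q.p₁ ∘ PQ.p₁) ∘ PQ-ψQ   ≈⟨ pullʳ (p₁∘pullback₁ pᵣ ψQ (Q.p₂∘universal ψQ-sq)) ⟩
            Q.p₁ ∘ (ψQ ∘ Zᵣ*.p₁)     ≈⟨ pullˡ (Q.p₁∘universal ψQ-sq) ⟩
            (ψᵢ ∘ lZ) ∘ Zᵣ*.p₁       ≈⟨ pullʳ (Eq.sym p₁∘lZ*) ⟩
            ψᵢ ∘ (Zᵢ*.p₁ ∘ lZ*)      ≈˘⟨ extendˡ (p₁∘pullback₁ pᵢ ψᵢ (Eᵢ.π∘lam tᵢ)) ⟩
            Pᵢ.p₁ ∘ (Pᵢ-ψᵢ ∘ lZ*)    ∎)
          (begin
            Pᵢ.p₂ ∘ (PQ⇒Pᵢ ∘ PQ-ψQ)  ≈⟨ pullˡ (Pᵢ.p₂∘universal PQ⇒Pᵢ-sq) ⟩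
            (lY ∘ PQ.p₂) ∘ PQ-ψQ     ≈⟨ pullʳ (p₂∘pullback₁ pᵣ ψQ (Q.p₂∘universal ψQ-sq)) ⟩
            lY ∘ Zᵣ*.p₂              ≈˘⟨ p₂∘lZ* ⟩
            Zᵢ*.p₂ ∘ lZ*             ≈˘⟨ pullˡ (p₂∘pullback₁ pᵢ ψᵢ (Eᵢ.π∘lam tᵢ)) ⟩
            Pᵢ.p₂ ∘ (Pᵢ-ψᵢ ∘ lZ*)    ∎)

        evQ∘PQ-ψQ : evQ ∘ PQ-ψQ ≈ φ*
        evQ∘PQ-ψQ = PB-ext
          (begin
            A*.p₁ ∘ (evQ ∘ PQ-ψQ)    ≈⟨ pullˡ (A*.p₁∘universal evQ-sq) ⟩
            (Eᵢ.ev ∘ PQ⇒Pᵢ) ∘ PQ-ψQ  ≈⟨ pullʳ PQ⇒Pᵢ∘PQ-ψQ ⟩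
            Eᵢ.ev ∘ (Pᵢ-ψᵢ ∘ lZ*)    ≈⟨ pullˡ (Eᵢ.ev-β tᵢ (p₁∘pullback₁ pᵢ ψᵢ (Eᵢ.π∘lam tᵢ))
                                                        (p₂∘pullback₁ pᵢ ψᵢ (Eᵢ.π∘lam tᵢ))) ⟩
            φᵢ ∘ lZ*                 ≈˘⟨ A*.p₁∘universal φ*-sq ⟩
            A*.p₁ ∘ φ*               ∎)
          (begin
            A*.p₂ ∘ (evQ ∘ PQ-ψQ)    ≈⟨ pullˡ A*-p₂∘evQ ⟩
            PQ.p₂ ∘ PQ-ψQ            ≈⟨ p₂∘pullback₁ pᵣ ψQ (Q.p₂∘universal ψQ-sq) ⟩
            Zᵣ*.p₂                   ≈˘⟨ A*-p₂∘φ* ⟩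
            A*.p₂ ∘ φ*               ∎)

        postcompose∘ψᵣ : postcompose ∘ ψᵣ ≈ E*.lam zᵣ φ* A*-p₂∘φ*
        postcompose∘ψᵣ = E*.lam-unique A*-p₂∘φ* (postcompose ∘ ψᵣ)
          (Eq.trans (pullˡ π∘postcompose) (Eᵣ.π∘lam tᵣ))
          (begin
            P*.p₁ ∘ (P*-postcompose ∘ Pᵣ-ψᵣ)  ≈⟨ pullˡ (p₁∘pullback₁ pᵣ postcompose π∘postcompose) ⟩
            (postcompose ∘ Pᵣ.p₁) ∘ Pᵣ-ψᵣ     ≈⟨ pullʳ (p₁∘pullback₁ pᵣ ψᵣ (Eᵣ.π∘lam tᵣ)) ⟩
            postcompose ∘ (ψᵣ ∘ Zᵣ*.p₁)       ≈˘⟨ assoc ⟩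
            (postcompose ∘ ψᵣ) ∘ Zᵣ*.p₁       ∎)
          (Eq.trans (pullˡ (p₂∘pullback₁ pᵣ postcompose π∘postcompose)) (p₂∘pullback₁ pᵣ ψᵣ (Eᵣ.π∘lam tᵣ)))
          (begin
            E*.ev ∘ (P*-postcompose ∘ Pᵣ-ψᵣ)  ≈⟨ pullˡ ev∘P*-postcompose ⟩
            (lA* ∘ Eᵣ.ev) ∘ Pᵣ-ψᵣ             ≈⟨ pullʳ (Eᵣ.ev-β tᵣ (p₁∘pullback₁ pᵣ ψᵣ (Eᵣ.π∘lam tᵣ))
                                                                (p₂∘pullback₁ pᵣ ψᵣ (Eᵣ.π∘lam tᵣ))) ⟩
            lA* ∘ φᵣ                          ≈⟨ lA*∘φᵣ ⟩
            φ*                                ∎)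

        beckChevalley∘ψQ : beckChevalley ∘ ψQ ≈ E*.lam zᵣ φ* A*-p₂∘φ*
        beckChevalley∘ψQ = E*.lam-unique A*-p₂∘φ* (beckChevalley ∘ ψQ)
          (Eq.trans (pullˡ π∘beckChevalley) (Q.p₂∘universal ψQ-sq))
          (begin
            P*.p₁ ∘ (P*-beckChevalley ∘ PQ-ψQ)  ≈⟨ pullˡ (p₁∘pullback₁ pᵣ beckChevalley π∘beckChevalley) ⟩
            (beckChevalley ∘ PQ.p₁) ∘ PQ-ψQ     ≈⟨ pullʳ (p₁∘pullback₁ pᵣ ψQ (Q.p₂∘universal ψQ-sq)) ⟩
            beckChevalley ∘ (ψQ ∘ Zᵣ*.p₁)       ≈˘⟨ assoc ⟩
            (beckChevalley ∘ ψQ) ∘ Zᵣ*.p₁       ∎)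
          (Eq.trans (pullˡ (p₂∘pullback₁ pᵣ beckChevalley π∘beckChevalley))
                    (p₂∘pullback₁ pᵣ ψQ (Q.p₂∘universal ψQ-sq)))
          (Eq.trans (pullˡ ev∘P*-beckChevalley) evQ∘PQ-ψQ)

        -- Both sides are the transpose of φ* = φᵢ restricted along lZ*, by φ-sq and by ev-β for Eᵢ.
        opaque
          compatible : postcompose ∘ ψᵣ ≈ beckChevalley ∘ ψQ
          compatible = Eq.trans postcompose∘ψᵣ (Eq.sym beckChevalley∘ψQ)

      ψ : Zᵣ ⇒ W.P
      ψ = W.universal ψᵣ ψQ compatible

      W-p₁∘ψ : W.p₁ ∘ ψ ≈ ψᵣ
      W-p₁∘ψ = W.p₁∘universal compatible

      leg∘ψ : leg ∘ ψ ≈ ψᵢ ∘ lZ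
      leg∘ψ = Eq.trans (pullʳ (W.p₂∘universal compatible)) (Q.p₁∘universal ψQ-sq)

      ψ-unique : (w : Zᵣ ⇒ W.P) → W.p₁ ∘ w ≈ ψᵣ → leg ∘ w ≈ ψᵢ ∘ lZ → w ≈ ψ
      ψ-unique w e₁ e₂ = W-ext (Eq.trans e₁ (Eq.sym W-p₁∘ψ)) (Eq.trans e₂ (Eq.sym leg∘ψ))

module SpanDependentProducts {o ℓ e} {R : Category o ℓ e} (FL : FiniteLimits R) where
  open HomReasoning R
  open ChosenPullbacks FL
  open SpanLimits FL
  open DependentProducts FL
  open SpanObj
  open Span⇒
  open _≈S_
  private
    module S = Category (Span R)

  module _ {X Y : SpanObj R} (p : Span⇒ R Y X)
           (Π₀ : Exponentiable (f₀ p)) (Πᵣ : Exponentiable (fᵣ p)) (Π₁ : Exponentiable (f₁ p)) where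
    private
      L : Functor (Slice (Span R) X) (Slice (Span R) Y)
      L = pullbackFunctor (Span R) spanFiniteLimits p
      module L = Functor L
      module p* {Z : SpanObj R} (z : Span⇒ R Z X) = Pullback (spanPullback z p)

      p₁∘L₁ : ∀ {a b} (u : Slice⇒ (Span R) a b) →
              p*.p₁ (SliceObj.arr b) S.∘ Slice⇒.h (L.F₁ u) S.≈ Slice⇒.h u S.∘ p*.p₁ (SliceObj.arr a)
      p₁∘L₁ {b = b} u = p*.p₁∘universal (SliceObj.arr b) _

      p₂∘L₁ : ∀ {a b} (u : Slice⇒ (Span R) a b) →
              p*.p₂ (SliceObj.arr b) S.∘ Slice⇒.h (L.F₁ u) S.≈ p*.p₂ (SliceObj.arr a)
      p₂∘L₁ {b = b} u = p*.p₂∘universal (SliceObj.arr b) _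

    module DependentProductOfSpans {A : SpanObj R} (a : Span⇒ R A Y) where
      module Leg₀ = LegConstruction (left-sq p) (left-sq a) Π₀ Πᵣ
      module Leg₁ = LegConstruction (right-sq p) (right-sq a) Π₁ Πᵣ
      module Eᵣ = DependentProduct (Πᵣ (fᵣ a))
      module Apex = PB Leg₀.W.p₁ Leg₁.W.p₁

      Πspan : SpanObj R
      Πspan = span (Leg₀.leg ∘ Apex.p₁) (Leg₁.leg ∘ Apex.p₂)

      sectionᵣ : Apex.P ⇒ Eᵣ.Π
      sectionᵣ = Leg₀.W.p₁ ∘ Apex.p₁

      πᵣ : Apex.P ⇒ Xᵣ X
      πᵣ = Eᵣ.π ∘ sectionᵣ

      π : Span⇒ R Πspan X
      π = spanarr Leg₀.Eᵢ.π πᵣ Leg₁.Eᵢ.π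
        (Eq.trans (pullˡ Leg₀.π∘leg) (Eq.trans assoc (refl⟩∘⟨ assoc)))
        (Eq.trans (pullˡ Leg₁.π∘leg)
                  (Eq.trans assoc (refl⟩∘⟨ Eq.trans assoc (refl⟩∘⟨ Eq.sym Apex.commute))))

      module π* = PB πᵣ (fᵣ p)

      π*⇒Pᵣ : π*.P ⇒ Leg₀.Pᵣ.P
      π*⇒Pᵣ = pullback₁ (fᵣ p) sectionᵣ Eq.refl

      p₁∘π*⇒Pᵣ : Leg₀.Pᵣ.p₁ ∘ π*⇒Pᵣ ≈ sectionᵣ ∘ π*.p₁
      p₁∘π*⇒Pᵣ = p₁∘pullback₁ (fᵣ p) sectionᵣ Eq.refl

      p₂∘π*⇒Pᵣ : Leg₀.Pᵣ.p₂ ∘ π*⇒Pᵣ ≈ π*.p₂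
      p₂∘π*⇒Pᵣ = p₂∘pullback₁ (fᵣ p) sectionᵣ Eq.refl

      ev : Span⇒ R (p*.P π) A
      ev = spanarr Leg₀.Eᵢ.ev (Eᵣ.ev ∘ π*⇒Pᵣ) Leg₁.Eᵢ.ev
        (Eq.sym (Leg₀.ev-sq Apex.p₁ p₁∘π*⇒Pᵣ p₂∘π*⇒Pᵣ
          (p₁∘pullbackMap (left-sq π) (left-sq p)) (p₂∘pullbackMap (left-sq π) (left-sq p))))
        (Eq.sym (Leg₁.ev-sq Apex.p₂ (Eq.trans p₁∘π*⇒Pᵣ (Apex.commute ⟩∘⟨refl)) p₂∘π*⇒Pᵣ
          (p₁∘pullbackMap (right-sq π) (right-sq p)) (p₂∘pullbackMap (right-sq π) (right-sq p))))

      a∘ev : a S.∘ ev S.≈ p*.p₂ π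
      a∘ev = record
        { eq₀ = Leg₀.Eᵢ.b∘ev
        ; eqᵣ = Eq.trans (pullˡ Eᵣ.b∘ev) p₂∘π*⇒Pᵣ
        ; eq₁ = Leg₁.Eᵢ.b∘ev
        }

      module _ {Z′} {z′ : Z′ ⇒ Xᵣ X} {K : PB.P z′ (fᵣ p) ⇒ π*.P} where
        p₁∘π*⇒Pᵣ∘ : ∀ {c : Z′ ⇒ Apex.P} → π*.p₁ ∘ K ≈ c ∘ PB.p₁ z′ (fᵣ p) →
                    Leg₀.Pᵣ.p₁ ∘ (π*⇒Pᵣ ∘ K) ≈ (sectionᵣ ∘ c) ∘ PB.p₁ z′ (fᵣ p)
        p₁∘π*⇒Pᵣ∘ p₁∘K = Eq.trans (pullˡ p₁∘π*⇒Pᵣ) (Eq.trans (pullʳ p₁∘K) (Eq.sym assoc))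

        p₂∘π*⇒Pᵣ∘ : π*.p₂ ∘ K ≈ PB.p₂ z′ (fᵣ p) → Leg₀.Pᵣ.p₂ ∘ (π*⇒Pᵣ ∘ K) ≈ PB.p₂ z′ (fᵣ p)
        p₂∘π*⇒Pᵣ∘ p₂∘K = Eq.trans (pullˡ p₂∘π*⇒Pᵣ) p₂∘K

      module Transpose {Z : SpanObj R} {z : Span⇒ R Z X} {φ : Span⇒ R (p*.P z) A}
                       (tri : a S.∘ φ S.≈ p*.p₂ z) where
        module T₀ = Leg₀.Transpose (left-sq z) (eq₀ tri) (eqᵣ tri)
          (p₁∘pullbackMap (left-sq z) (left-sq p)) (p₂∘pullbackMap (left-sq z) (left-sq p)) (left-sq φ)
        module T₁ = Leg₁.Transpose (right-sq z) (eq₁ tri) (eqᵣ tri)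
          (p₁∘pullbackMap (right-sq z) (right-sq p)) (p₂∘pullbackMap (right-sq z) (right-sq p)) (right-sq φ)

        opaque
          ψ-compatible : Leg₀.W.p₁ ∘ T₀.ψ ≈ Leg₁.W.p₁ ∘ T₁.ψ
          ψ-compatible = Eq.trans T₀.W-p₁∘ψ (Eq.sym T₁.W-p₁∘ψ)

        ψᵣ : Xᵣ Z ⇒ Apex.P
        ψᵣ = Apex.universal T₀.ψ T₁.ψ ψ-compatible

        ψ : Span⇒ R Z Πspan
        ψ = spanarr T₀.ψᵢ ψᵣ T₁.ψᵢ
          (Eq.sym (Eq.trans (pullʳ (Apex.p₁∘universal ψ-compatible)) T₀.leg∘ψ))
          (Eq.sym (Eq.trans (pullʳ (Apex.p₂∘universal ψ-compatible)) T₁.leg∘ψ))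

        sectionᵣ∘ψᵣ : sectionᵣ ∘ ψᵣ ≈ T₀.ψᵣ
        sectionᵣ∘ψᵣ = Eq.trans (pullʳ (Apex.p₁∘universal ψ-compatible)) T₀.W-p₁∘ψ

        π∘ψ : π S.∘ ψ S.≈ z
        π∘ψ = record
          { eq₀ = Leg₀.Eᵢ.π∘lam (eq₀ tri)
          ; eqᵣ = Eq.trans (pullʳ sectionᵣ∘ψᵣ) (Eᵣ.π∘lam (eqᵣ tri))
          ; eq₁ = Leg₁.Eᵢ.π∘lam (eq₁ tri)
          }

        transpose : Slice⇒ (Span R) (sliceobj z) (sliceobj π)
        transpose = slicearr π∘ψ

        ev∘transpose : ev S.∘ Slice⇒.h (L.F₁ transpose) S.≈ φ
        ev∘transpose = record
          { eq₀ = Leg₀.Eᵢ.ev-β (eq₀ tri) (eq₀ (p₁∘L₁ transpose)) (eq₀ (p₂∘L₁ transpose))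
          ; eqᵣ = Eq.trans assoc (Eᵣ.ev-β (eqᵣ tri)
                    (Eq.trans (p₁∘π*⇒Pᵣ∘ (eqᵣ (p₁∘L₁ transpose))) (sectionᵣ∘ψᵣ ⟩∘⟨refl))
                    (p₂∘π*⇒Pᵣ∘ (eqᵣ (p₂∘L₁ transpose))))
          ; eq₁ = Leg₁.Eᵢ.ev-β (eq₁ tri) (eq₁ (p₁∘L₁ transpose)) (eq₁ (p₂∘L₁ transpose))
          }

        transpose-unique : (g : Slice⇒ (Span R) (sliceobj z) (sliceobj π)) →
                           ev S.∘ Slice⇒.h (L.F₁ g) S.≈ φ → Slice⇒.h g S.≈ ψ
        transpose-unique (slicearr {g} π∘g) ev∘g = record { eq₀ = g₀≈ψ₀ ; eqᵣ = gᵣ≈ψᵣ ; eq₁ = g₁≈ψ₁ }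
          where
          g₀≈ψ₀ : f₀ g ≈ T₀.ψᵢ
          g₀≈ψ₀ = Leg₀.Eᵢ.lam-unique (eq₀ tri) (f₀ g) (eq₀ π∘g)
            (eq₀ (p₁∘L₁ (slicearr π∘g))) (eq₀ (p₂∘L₁ (slicearr π∘g))) (eq₀ ev∘g)

          g₁≈ψ₁ : f₁ g ≈ T₁.ψᵢ
          g₁≈ψ₁ = Leg₁.Eᵢ.lam-unique (eq₁ tri) (f₁ g) (eq₁ π∘g)
            (eq₁ (p₁∘L₁ (slicearr π∘g))) (eq₁ (p₂∘L₁ (slicearr π∘g))) (eq₁ ev∘g)

          sectionᵣ∘gᵣ : sectionᵣ ∘ fᵣ g ≈ T₀.ψᵣ
          sectionᵣ∘gᵣ = Eᵣ.lam-unique (eqᵣ tri) (sectionᵣ ∘ fᵣ g) (Eq.trans (Eq.sym assoc) (eqᵣ π∘g))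
            (p₁∘π*⇒Pᵣ∘ (eqᵣ (p₁∘L₁ (slicearr π∘g)))) (p₂∘π*⇒Pᵣ∘ (eqᵣ (p₂∘L₁ (slicearr π∘g))))
            (Eq.trans (Eq.sym assoc) (eqᵣ ev∘g))

          W₀-gᵣ : Leg₀.W.p₁ ∘ (Apex.p₁ ∘ fᵣ g) ≈ T₀.ψᵣ
          W₀-gᵣ = Eq.trans (Eq.sym assoc) sectionᵣ∘gᵣ

          W₁-gᵣ : Leg₁.W.p₁ ∘ (Apex.p₂ ∘ fᵣ g) ≈ T₁.ψᵣ
          W₁-gᵣ = Eq.trans (pullˡ (Eq.sym Apex.commute)) sectionᵣ∘gᵣ

          leg₀-gᵣ : Leg₀.leg ∘ (Apex.p₁ ∘ fᵣ g) ≈ T₀.ψᵢ ∘ left Z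
          leg₀-gᵣ = Eq.trans (Eq.sym assoc) (Eq.trans (Eq.sym (left-sq g)) (g₀≈ψ₀ ⟩∘⟨refl))

          leg₁-gᵣ : Leg₁.leg ∘ (Apex.p₂ ∘ fᵣ g) ≈ T₁.ψᵢ ∘ right Z
          leg₁-gᵣ = Eq.trans (Eq.sym assoc) (Eq.trans (Eq.sym (right-sq g)) (g₁≈ψ₁ ⟩∘⟨refl))

          gᵣ≈ψᵣ : fᵣ g ≈ ψᵣ
          gᵣ≈ψᵣ = PB-ext
            (Eq.trans (T₀.ψ-unique _ W₀-gᵣ leg₀-gᵣ) (Eq.sym (Apex.p₁∘universal ψ-compatible)))
            (Eq.trans (T₁.ψ-unique _ W₁-gᵣ leg₁-gᵣ) (Eq.sym (Apex.p₂∘universal ψ-compatible)))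

      couniversal : CouniversalArrow L (sliceobj a)
      couniversal = record
        { G₀               = sliceobj π
        ; ε                = slicearr a∘ev
        ; transpose        = λ f → Transpose.transpose (Slice⇒.triangle f)
        ; ε∘transpose      = λ f → Transpose.ev∘transpose (Slice⇒.triangle f)
        ; transpose-unique = λ {_} {f} g → Transpose.transpose-unique (Slice⇒.triangle f) g
        }

    pullbackFunctor-hasRightAdjoint : HasRightAdjoint L
    pullbackFunctor-hasRightAdjoint =
      rightAdjoint L (λ b → DependentProductOfSpans.couniversal (SliceObj.arr b))

mainTheorem5 : ∀ {o ℓ e r : Level} (R : Category o ℓ e)
                 (Rep : ∀ {A B} → Category._⇒_ R A B → Set r) →
                 IsRMC R Rep → IsRMC (Span R) (LevelwiseRep R Rep)
mainTheorem5 R Rep rmc = record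
  { finiteLimits        = spanFiniteLimits finiteLimits
  ; rep-pullback-stable = levelwise-closedUnderPullback finiteLimits rep-pullback-stable
  ; rep-exponentiable   = λ p (r₀ , rᵣ , r₁) →
      pullbackFunctor-hasRightAdjoint finiteLimits p (exponential r₀) (exponential rᵣ) (exponential r₁)
  }
  where
  open IsRMC rmc
  open SpanLimits using (spanFiniteLimits; levelwise-closedUnderPullback)
  open SpanDependentProducts using (pullbackFunctor-hasRightAdjoint)

  exponential : ∀ {X Y} {f : Category._⇒_ R Y X} → Rep f → DependentProducts.Exponentiable finiteLimits f
  exponential {f = f} rep = DependentProducts.exponentiable finiteLimits (rep-exponentiable f rep)
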